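{- Every $\infty$-proof $\pi$ of $\mathsf{S}$ can be properly annotated, i.e. there is a properly annotated $\infty$-proof which becomes $\pi$ after erasing all annotations. Moreover, if $\pi$ is regular, the annotated $\infty$-proof can be chosen to be regular.
   Context: Formulas are built from propositional variables and $\bot$ by $\to$, $\Box$, $\Box^+$. A sequent is $\Gamma\Rightarrow\Delta$ with $\Gamma,\Delta$ finite multisets. The calculus $\mathsf{S}$ has rules: axioms $\Gamma,p\Rightarrow p,\Delta$ and $\Gamma,\bot\Rightarrow\Delta$; $(\to_L)$: from $\Gamma,B\Rightarrow\Delta$ and $\Gamma\Rightarrow A,\Delta$ infer $\Gamma,A\to B\Rightarrow\Delta$; $(\to_R)$: from $\Gamma,A\Rightarrow B,\Delta$ infer $\Gamma\Rightarrow A\to B,\Delta$; $(\Box)$: from $\Sigma,\Pi,\Box^+\Pi\Rightarrow A$ infer $\Upsilon,\Box\Sigma,\Box^+\Pi\Rightarrow\Box A,\Lambda$; $(\Box^+)$: from left premise $\Sigma,\Pi,\Box^+\Pi\Rightarrow A$ and right premise $\Sigma,\Pi,\Box^+\Pi\Rightarrow\Box^+A$ infer $\Upsilon,\Box\Sigma,\Box^+\Pi\Rightarrow\Box^+A,\Lambda$ (principal formulas $\Box A$, $\Box^+A$). An $\infty$-proof is a possibly infinite tree of sequents built according to these rules (leaves are axioms) such that every infinite branch has a tail in which all $(\Box^+)$-applications have the same principal formula, which passes through the right premise of $(\Box^+)$ infinitely often, never through the left premise of $(\Box^+)$, and contains no $(\Box)$-application. Regular: finitely many pairwise non-isomorphic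 subtrees. An annotated formula is a formula in which each occurrence of a modal connective carries a natural-number label, written $\Box_i$, $\Box^+_i$. It is properly annotated if distinct occurrences of $\Box$ carry distinct labels and distinct occurrences of $\Box^+$ carry distinct labels. An annotated sequent is $\Gamma\Rightarrow_\alpha\Delta$ with $\Gamma,\Delta$ finite multisets of annotated formulas and $\alpha$ either an annotated formula $\Box^+_nC$ belonging to $\Delta$ or the sign $\ast$; moreover, negative occurrences of modal connectives in $\bigwedge\Gamma\to\bigvee\Delta$ carry even labels and positive ones odd labels. It is properly annotated if $\bigwedge\Gamma\to\bigvee\Delta$ is properly annotated. Annotated rules: axioms $\Gamma,p\Rightarrow_\alpha p,\Delta$ and $\Gamma,\bot\Rightarrow_\alpha\Delta$; $(\to_L)$, $(\to_R)$ as in $\mathsf{S}$ with the same subscript $\alpha$ on conclusion and premises; $(\Box_m)$: from $A_1,\dots,A_k,B_1,\dots,B_l,\Box^+_{j_1}B_1,\dots,\Box^+_{j_l}B_l\Rightarrow_\ast C$ infer $\Upsilon,\Box_{i_1}A_1,\dots,\Box_{i_k}A_k,\Box^+_{j_1}B_1,\dots,\Box^+_{j_l}B_l\Rightarrow_\alpha\Box_mC,\Lambda$; $(\Box^+_n)$: from the left premise $\Sigma,\Pi,\Box^+_{j_1}B_1,\dots,\Box^+_{j_l}B_l\Rightarrow_\ast C$ and the right premise $\Sigma,\Pi,\Box^+_{j_1}B_1,\dots,\Box^+_{j_l}B_l\Rightarrow_{\Box^+_nC}\Box^+_nC$ infer $\Upsilon,\Box_{i_1}A_1,\dots,\Box_{i_k}A_k,\Box^+_{j_1}B_1,\dots,\Box^+_{j_l}B_l\Rightarrow_\alpha\Box^+_nC,\Lambda$,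 where $\Sigma=A_1,\dots,A_k$ and $\Pi=B_1,\dots,B_l$. An annotated $\infty$-proof is a possibly infinite tree of annotated sequents built by annotated rules such that every infinite branch has a tail in which all sequents have the same subscript formula $\Box^+_nC$ and which passes through the right premise of an application of $(\Box^+_n)$ infinitely often. It is regular if it has finitely many non-isomorphic subtrees (with respect to the annotated labelling), and properly annotated if its root sequent is properly annotated. Erasing annotations removes all labels and subscripts. -}

module Defs where

open import Data.Nat using (ℕ; zero; suc; _<_; _≤_; _%_)
open import Data.Bool using (Bool; true; false; not)
open import Data.List using (List; []; _∷_; _++_; [_]; map; concatMap)
open import Data.List.Relation.Binary.Permutation.Propositional using (_↭_)
open import Data.List.Relation.Unary.Unique.Propositional using (Unique)
open import Data.List.Relation.Unary.All using (All)
open import Data.List.Membership.Propositional using (_∈_)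
open import Data.Maybe using (Maybe; just; nothing)
open import Data.Product using (∃; ∃-syntax; _×_; _,_; proj₁; proj₂)
open import Data.Unit using (⊤)
open import Data.Empty using (⊥)
open import Relation.Binary.PropositionalEquality using (_≡_)

data Fm : Set where
  var  : ℕ → Fm
  bot  : Fm
  _⇒_  : Fm → Fm → Fm
  □    : Fm → Fm
  □⁺   : Fm → Fm

infixr 5 _⇒_

-- Sequents Γ ⇒ Δ; multisets are represented by lists, and every rule is
-- stated up to permutation (_↭_) of both sides.
record Seq : Set where
  constructor _⊢_
  field
    ant : List Fm
    succ : List Fm

_≈S_ : Seq → Seq → Set
(Γ ⊢ Δ) ≈S (Γ' ⊢ Δ') = (Γ ↭ Γ') × (Δ ↭ Δ')

-- Generic (possibly infinite) finitely branching trees, given as a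
-- labelling of positions; the arity of a node is determined by its label.
-- A position is the list of child indices from the root.

Pos : Set
Pos = List ℕ

module Trees {L : Set} (arity : L → ℕ) where

  data Valid (T : Pos → L) : Pos → Set where
    root  : Valid T []
    child : ∀ {p i} → Valid T p → i < arity (T p) → Valid T (p ++ [ i ])

  subtree : (Pos → L) → Pos → (Pos → L)
  subtree T p q = T (p ++ q)

  -- the first n steps of a branch b (b n = child index chosen at depth n)
  pref : (ℕ → ℕ) → ℕ → Pos
  pref b zero    = []
  pref b (suc n) = pref b n ++ [ b n ]

  InfBranch : (Pos → L) → (ℕ → ℕ) → Set
  InfBranch T b = ∀ n → b n < arity (T (pref b n))

  Iso : (Pos → L) → Pos → Pos → Set
  Iso T p q = ∀ r → Valid (subtree T p) r → T (p ++ r) ≡ T (q ++ r)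

  Regular : (Pos → L) → Set
  Regular T = ∃[ ps ] ((∀ q → q ∈ ps → Valid T q)
                      × (∀ p → Valid T p → ∃[ q ] (q ∈ ps × Iso T p q)))

data RuleS : Set where
  axp ax⊥ impL impR box : RuleS
  boxp : Fm → RuleS

arityS : RuleS → ℕ
arityS axp      = 0
arityS ax⊥      = 0
arityS impL     = 2
arityS impR     = 1
arityS box      = 1
arityS (boxp _) = 2

-- StepS s r ch : s is the conclusion of rule r with premises ch 0, ch 1, ...
-- (for (→L): ch 0 = Γ,B ⇒ Δ, ch 1 = Γ ⇒ A,Δ; for (□⁺): ch 0 left, ch 1 right premise)
StepS : Seq → RuleS → (ℕ → Seq) → Set
StepS s axp ch = ∃[ p ] ∃[ Γ ] ∃[ Δ ] (s ≈S ((var p ∷ Γ) ⊢ (var p ∷ Δ)))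
StepS s ax⊥ ch = ∃[ Γ ] ∃[ Δ ] (s ≈S ((bot ∷ Γ) ⊢ Δ))
StepS s impL ch = ∃[ A ] ∃[ B ] ∃[ Γ ] ∃[ Δ ]
  (s ≈S (((A ⇒ B) ∷ Γ) ⊢ Δ) × ch 0 ≈S ((B ∷ Γ) ⊢ Δ) × ch 1 ≈S (Γ ⊢ (A ∷ Δ)))
StepS s impR ch = ∃[ A ] ∃[ B ] ∃[ Γ ] ∃[ Δ ]
  (s ≈S (Γ ⊢ ((A ⇒ B) ∷ Δ)) × ch 0 ≈S ((A ∷ Γ) ⊢ (B ∷ Δ)))
StepS s box ch = ∃[ A ] ∃[ Υ ] ∃[ Sg ] ∃[ Pi ] ∃[ Λ ]
  (s ≈S ((Υ ++ map □ Sg ++ map □⁺ Pi) ⊢ (□ A ∷ Λ))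
   × ch 0 ≈S ((Sg ++ Pi ++ map □⁺ Pi) ⊢ [ A ]))
StepS s (boxp A) ch = ∃[ Υ ] ∃[ Sg ] ∃[ Pi ] ∃[ Λ ]
  (s ≈S ((Υ ++ map □ Sg ++ map □⁺ Pi) ⊢ (□⁺ A ∷ Λ))
   × ch 0 ≈S ((Sg ++ Pi ++ map □⁺ Pi) ⊢ [ A ])
   × ch 1 ≈S ((Sg ++ Pi ++ map □⁺ Pi) ⊢ [ □⁺ A ]))

NodeS : Set
NodeS = Seq × RuleS

module TS = Trees {NodeS} (λ x → arityS (proj₂ x))

-- tail condition at one node of a branch, for the fixed principal formula □⁺ A:
-- no (□); every (□⁺) has principal formula □⁺ A and the branch goes to the
-- right premise (index 1), never to the left one.
GoodS : Fm → RuleS → ℕ → Set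
GoodS A box       d = ⊥
GoodS A (boxp A') d = (A' ≡ A) × (d ≡ 1)
GoodS A _         d = ⊤

record InfProofS : Set where
  field
    tree   : Pos → NodeS
    local  : ∀ p → TS.Valid tree p →
             StepS (proj₁ (tree p)) (proj₂ (tree p)) (λ i → proj₁ (tree (p ++ [ i ])))
    branch : ∀ b → TS.InfBranch tree b →
             ∃[ N ] ∃[ A ]
               ((∀ n → N ≤ n → GoodS A (proj₂ (tree (TS.pref b n))) (b n))
               × (∀ m → ∃[ n ] (m ≤ n × proj₂ (tree (TS.pref b n)) ≡ boxp A × b n ≡ 1)))

RegularS : InfProofS → Set
RegularS π = TS.Regular (InfProofS.tree π)

data AFm : Set where
  avar  : ℕ → AFm
  abot  : AFm
  _a⇒_  : AFm → AFm → AFm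
  a□    : ℕ → AFm → AFm
  a□⁺   : ℕ → AFm → AFm

infixr 5 _a⇒_

erase : AFm → Fm
erase (avar p)  = var p
erase abot      = bot
erase (A a⇒ B)  = erase A ⇒ erase B
erase (a□ i A)  = □ (erase A)
erase (a□⁺ i A) = □⁺ (erase A)

boxLabs : AFm → List ℕ
boxLabs (avar _)  = []
boxLabs abot      = []
boxLabs (A a⇒ B)  = boxLabs A ++ boxLabs B
boxLabs (a□ i A)  = i ∷ boxLabs A
boxLabs (a□⁺ i A) = boxLabs A

boxpLabs : AFm → List ℕ
boxpLabs (avar _)  = []
boxpLabs abot      = []
boxpLabs (A a⇒ B)  = boxpLabs A ++ boxpLabs B
boxpLabs (a□ i A)  = boxpLabs A
boxpLabs (a□⁺ i A) = i ∷ boxpLabs A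

ProperList : List AFm → Set
ProperList Fs = Unique (concatMap boxLabs Fs) × Unique (concatMap boxpLabs Fs)

Even Odd : ℕ → Set
Even i = i % 2 ≡ 0
Odd  i = i % 2 ≡ 1

-- polarity condition: true = positive occurrence (odd labels), false = negative (even labels)
LabPol : Bool → ℕ → Set
LabPol true  i = Odd i
LabPol false i = Even i

Pol : Bool → AFm → Set
Pol b (avar _)  = ⊤
Pol b abot      = ⊤
Pol b (A a⇒ B)  = Pol (not b) A × Pol b B
Pol b (a□ i A)  = LabPol b i × Pol b A
Pol b (a□⁺ i A) = LabPol b i × Pol b A

-- Annotated sequents  Γ ⇒_α Δ ; sub = just (n , C) means α = □⁺_n C, nothing means α = ∗
record ASeq : Set where
  constructor aseq
  field
    ant : List AFm
    succ : List AFm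
    sub : Maybe (ℕ × AFm)

WFA : ASeq → Set
WFA (aseq Γ Δ α) =
  (∀ n C → α ≡ just (n , C) → a□⁺ n C ∈ Δ) × All (Pol false) Γ × All (Pol true) Δ

-- properly annotated sequent: ⋀Γ → ⋁Δ is properly annotated
ProperASeq : ASeq → Set
ProperASeq (aseq Γ Δ α) = ProperList (Γ ++ Δ)

_≈A_ : ASeq → ASeq → Set
aseq Γ Δ α ≈A aseq Γ' Δ' α' = (Γ ↭ Γ') × (Δ ↭ Δ') × (α ≡ α')

data RuleA : Set where
  aaxp aax⊥ aimpL aimpR : RuleA
  abox  : ℕ → RuleA
  aboxp : ℕ → AFm → RuleA

eraseRule : RuleA → RuleS
eraseRule aaxp        = axp
eraseRule aax⊥        = ax⊥
eraseRule aimpL       = impL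
eraseRule aimpR       = impR
eraseRule (abox _)    = box
eraseRule (aboxp _ C) = boxp (erase C)

arityA : RuleA → ℕ
arityA r = arityS (eraseRule r)

boxL boxpL : ℕ × AFm → AFm
boxL  (i , A) = a□ i A
boxpL (j , B) = a□⁺ j B

StepA : ASeq → RuleA → (ℕ → ASeq) → Set
StepA s aaxp ch = ∃[ p ] ∃[ Γ ] ∃[ Δ ] ∃[ α ] (s ≈A aseq (avar p ∷ Γ) (avar p ∷ Δ) α)
StepA s aax⊥ ch = ∃[ Γ ] ∃[ Δ ] ∃[ α ] (s ≈A aseq (abot ∷ Γ) Δ α)
StepA s aimpL ch = ∃[ A ] ∃[ B ] ∃[ Γ ] ∃[ Δ ] ∃[ α ]
  (s ≈A aseq ((A a⇒ B) ∷ Γ) Δ α × ch 0 ≈A aseq (B ∷ Γ) Δ α × ch 1 ≈A aseq Γ (A ∷ Δ) α)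
StepA s aimpR ch = ∃[ A ] ∃[ B ] ∃[ Γ ] ∃[ Δ ] ∃[ α ]
  (s ≈A aseq Γ ((A a⇒ B) ∷ Δ) α × ch 0 ≈A aseq (A ∷ Γ) (B ∷ Δ) α)
StepA s (abox m) ch = ∃[ C ] ∃[ Υ ] ∃[ Sg ] ∃[ Pi ] ∃[ Λ ] ∃[ α ]
  (s ≈A aseq (Υ ++ map boxL Sg ++ map boxpL Pi) (a□ m C ∷ Λ) α
   × ch 0 ≈A aseq (map proj₂ Sg ++ map proj₂ Pi ++ map boxpL Pi) [ C ] nothing)
StepA s (aboxp n C) ch = ∃[ Υ ] ∃[ Sg ] ∃[ Pi ] ∃[ Λ ] ∃[ α ]
  (s ≈A aseq (Υ ++ map boxL Sg ++ map boxpL Pi) (a□⁺ n C ∷ Λ) α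
   × ch 0 ≈A aseq (map proj₂ Sg ++ map proj₂ Pi ++ map boxpL Pi) [ C ] nothing
   × ch 1 ≈A aseq (map proj₂ Sg ++ map proj₂ Pi ++ map boxpL Pi) [ a□⁺ n C ] (just (n , C)))

NodeA : Set
NodeA = ASeq × RuleA

module TA = Trees {NodeA} (λ x → arityA (proj₂ x))

IsBoxpN : ℕ → RuleA → Set
IsBoxpN n (aboxp n' _) = n' ≡ n
IsBoxpN n _            = ⊥

record InfProofA : Set where
  field
    tree   : Pos → NodeA
    wf     : ∀ p → TA.Valid tree p → WFA (proj₁ (tree p))
    local  : ∀ p → TA.Valid tree p →
             StepA (proj₁ (tree p)) (proj₂ (tree p)) (λ i → proj₁ (tree (p ++ [ i ])))
    branch : ∀ b → TA.InfBranch tree b →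
             ∃[ N ] ∃[ n ] ∃[ C ]
               ((∀ k → N ≤ k → ASeq.sub (proj₁ (tree (TA.pref b k))) ≡ just (n , C))
               × (∀ m → ∃[ k ] (m ≤ k × IsBoxpN n (proj₂ (tree (TA.pref b k))) × b k ≡ 1)))

RegularA : InfProofA → Set
RegularA τ = TA.Regular (InfProofA.tree τ)

ProperA : InfProofA → Set
ProperA τ = ProperASeq (proj₁ (InfProofA.tree τ []))

eraseSeq : ASeq → Seq
eraseSeq (aseq Γ Δ α) = map erase Γ ⊢ map erase Δ

eraseNode : NodeA → NodeS
eraseNode (s , r) = eraseSeq s , eraseRule r

Erases : InfProofA → InfProofS → Set
Erases τ π = ∀ p → TA.Valid (InfProofA.tree τ) p →
             eraseNode (InfProofA.tree τ p) ≡ InfProofS.tree π p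

{-# OPTIONS --safe #-}
module Submission where

-- Number the modal occurrences of the root sequent with pairwise distinct
-- labels, even on negative and odd on positive occurrences, and push the
-- annotation up the proof: every formula of a premise is an annotated
-- subformula of a formula of the conclusion, so polarities are respected and
-- only the labels of the root occur.  The subscript is set at the right premise
-- of a (□⁺) and copied through the other rules; a (□⁺) whose principal formula
-- erases to the erasure of the current subscript takes the subscript itself as
-- principal annotated formula.  On the tail of an infinite branch π applies
-- (□⁺) with one principal formula only and always moves to the right premise,
-- so there the subscript is eventually constant.
--
-- The annotation of a node is determined by an isomorphic copy of the subtree
-- of π above it together with its annotated sequent.  For regular π these range
-- over finitely many subtrees and finitely many sequents with labels below the
-- root bound, so the annotated proof has finitely many subtrees as well.


open import Defs
open import Data.Bool using (Bool; true; false; not)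
open import Data.Empty using (⊥-elim)
open import Data.List
  using (List; []; _∷_; _++_; [_]; map; concat; concatMap; cartesianProduct; cartesianProductWith; length; take; drop; upTo)
open import Data.List.Properties using (++-assoc; ++-identityʳ; ∷-injective; length-map; map-++; concat-++; take++drop≡id)
import Data.List.Properties as List
open import Data.List.Membership.Propositional using (_∈_; lose; find)
open import Data.List.Membership.Propositional.Properties
  using (∈-∃++; ∈-++⁻; ∈-map⁺; ∈-map⁻; ∈-concatMap⁺; ∈-upTo⁺; ∈-upTo⁻; ∈-cartesianProductWith⁺; ∈-cartesianProduct⁺)
import Data.List.Membership.DecPropositional as DecMembership
open import Data.List.Relation.Binary.Permutation.Propositional
  using (_↭_; ↭-refl; ↭-swap; ↭-sym; ↭-trans; ↭-prep; ↭-reflexive)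
open import Data.List.Relation.Binary.Permutation.Propositional.Properties
  using (∈-resp-↭; All-resp-↭; shift; ↭-length; ↭-empty-inv; drop-∷; map⁺)
open import Data.List.Relation.Unary.All using (All; []; _∷_)
import Data.List.Relation.Unary.All as All
import Data.List.Relation.Unary.All.Properties as All
open import Data.List.Relation.Unary.All.Properties using (¬All⇒Any¬; ¬Any⇒All¬)
open import Data.List.Relation.Unary.Any using (here; there)
open import Data.List.Relation.Unary.AllPairs using (AllPairs; []; _∷_)
import Data.List.Relation.Unary.AllPairs as AllPairs
import Data.List.Relation.Unary.AllPairs.Properties as AllPairs
open import Data.List.Relation.Unary.Unique.Propositional using (Unique)
open import Data.Maybe using (Maybe; just; nothing)
import Data.Maybe as Maybe
import Data.Maybe.Properties as Maybe
import Data.Product as Product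
import Data.Product.Properties as Product
open import Data.Nat using (ℕ; _≟_; zero; suc; _<_; _≤_; _<?_; z≤n; s≤s; _*_; _+_)
open import Data.Nat.Properties
  using (m≤m+n; m≤n+m; m≤n⇒m<n∨m≡n; ≤-refl; ≤-trans; <-irrefl; ≤-<-trans; <-≤-trans; <⇒≤; <⇒≢; n≤1+n; *-monoˡ-≤; +-identityʳ; +-suc)
open import Data.Nat.DivMod using (m*n%n≡0; [m+kn]%n≡m%n)
open import Data.Product using (∃-syntax; _×_; _,_; proj₁; proj₂)
open import Data.Sum using (inj₁; inj₂)
open import Data.Unit using (⊤; tt)
open import Relation.Binary.Definitions using (DecidableEquality)
open import Relation.Binary.PropositionalEquality
  using (_≡_; refl; sym; trans; cong; cong₂; subst; subst₂; module ≡-Reasoning)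
open import Relation.Nullary using (Dec; yes; no)
open import Relation.Nullary.Decidable using (map′; _×-dec_)

open ≡-Reasoning

Unique⊆⇒length≤ : {A : Set} {xs ys : List A} → Unique xs → (∀ {x} → x ∈ xs → x ∈ ys) → length xs ≤ length ys
Unique⊆⇒length≤ {xs = []}     _        _  = z≤n
Unique⊆⇒length≤ {xs = x ∷ xs} (x∉ ∷ u) xs⊆ with ys₁ , ys₂ , refl ← ∈-∃++ (xs⊆ (here refl)) =
  subst (suc (length xs) ≤_) (sym (↭-length (shift x ys₁ ys₂))) (s≤s (Unique⊆⇒length≤ u xs⊆ys))
  where
  xs⊆ys : ∀ {y} → y ∈ xs → y ∈ ys₁ ++ ys₂
  xs⊆ys y∈ with ∈-resp-↭ (shift x ys₁ ys₂) (xs⊆ (there y∈))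
  ... | here y≡x = ⊥-elim (All.lookup x∉ y∈ (sym y≡x))
  ... | there y∈′ = y∈′

∈⇒↭ : {A : Set} {x : A} {xs : List A} → x ∈ xs → ∃[ ys ] (xs ↭ x ∷ ys)
∈⇒↭ {x = x} x∈ with ys , zs , refl ← ∈-∃++ x∈ = ys ++ zs , shift x ys zs

map-≡-++⁻ : {A B : Set} (f : A → B) (L : List A) (X Y : List B) {n : ℕ} → length X ≡ n → map f L ≡ X ++ Y →
            map f (take n L) ≡ X × map f (drop n L) ≡ Y
map-≡-++⁻ f L       []      Y refl e = refl , e
map-≡-++⁻ f (x ∷ L) (_ ∷ X) Y refl e with refl , e′ ← ∷-injective e =
  Product.map₁ (cong (f x ∷_)) (map-≡-++⁻ f L X Y refl e′)

concatMap-++ : ∀ {A B : Set} (f : A → List B) xs ys → concatMap f (xs ++ ys) ≡ concatMap f xs ++ concatMap f ys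
concatMap-++ f xs ys = trans (cong concat (map-++ f xs ys)) (sym (concat-++ (map f xs) (map f ys)))

holds-from : ∀ {P : ℕ → Set} k₀ → P k₀ → (∀ k → k₀ ≤ k → P k → P (suc k)) → ∀ k → k₀ ≤ k → P k
holds-from k₀ Pk₀ step zero    z≤n = Pk₀
holds-from k₀ Pk₀ step (suc k) k₀≤ with m≤n⇒m<n∨m≡n k₀≤
... | inj₁ (s≤s k₀≤k) = step k k₀≤k (holds-from k₀ Pk₀ step k k₀≤k)
... | inj₂ refl       = Pk₀

-- Trees

module TreeFacts {L : Set} (arity : L → ℕ) where
  open Trees arity

  valid-++ : ∀ {T p r} → Valid T p → Valid (subtree T p) r → Valid T (p ++ r)
  valid-++ {T} {p} v root = subst (Valid T) (sym (++-identityʳ p)) v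
  valid-++ {T} {p} v (child {r} {j} w j<) = subst (Valid T) (++-assoc p r [ j ]) (child (valid-++ v w) j<)

  valid-ext : ∀ {T T′} → (∀ p → T p ≡ T′ p) → ∀ {p} → Valid T p → Valid T′ p
  valid-ext e root = root
  valid-ext {T} {T′} e (child {p} {i} v i<) = child (valid-ext e v) (subst (λ x → i < arity x) (e p) i<)

  -- Valid is generated by appending at the end of a position; reading a
  -- position from the root instead is structurally recursive, hence decidable.
  ValidFromRoot : (Pos → L) → Pos → Set
  ValidFromRoot T []      = ⊤
  ValidFromRoot T (i ∷ r) = i < arity (T []) × ValidFromRoot (subtree T [ i ]) r

  validFromRoot? : ∀ T p → Dec (ValidFromRoot T p)
  validFromRoot? T []      = yes tt
  validFromRoot? T (i ∷ r) = (i <? arity (T [])) ×-dec validFromRoot? (subtree T [ i ]) r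

  fromRoot⇒valid : ∀ T p → ValidFromRoot T p → Valid T p
  fromRoot⇒valid T []      _        = root
  fromRoot⇒valid T (i ∷ r) (i< , v) = valid-++ {T} {[ i ]} (child root i<) (fromRoot⇒valid (subtree T [ i ]) r v)

  fromRoot-snoc : ∀ T p {i} → ValidFromRoot T p → i < arity (T p) → ValidFromRoot T (p ++ [ i ])
  fromRoot-snoc T []      _        i< = i< , tt
  fromRoot-snoc T (j ∷ p) (j< , v) i< = j< , fromRoot-snoc (subtree T [ j ]) p v i<

  valid⇒fromRoot : ∀ {T p} → Valid T p → ValidFromRoot T p
  valid⇒fromRoot root                    = tt
  valid⇒fromRoot {T} (child {p} v i<) = fromRoot-snoc T p (valid⇒fromRoot v) i<

  valid? : ∀ T p → Dec (Valid T p)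
  valid? T p = map′ (fromRoot⇒valid T p) valid⇒fromRoot (validFromRoot? T p)

  Iso⇒≡ : ∀ {T p q} → Iso T p q → T p ≡ T q
  Iso⇒≡ {T} {p} {q} I = subst₂ (λ x y → T x ≡ T y) (++-identityʳ p) (++-identityʳ q) (I [] root)

  Iso-valid : ∀ {T p q} → Iso T p q → ∀ {r} → Valid (subtree T p) r → Valid (subtree T q) r
  Iso-valid I root = root
  Iso-valid {T} {p} {q} I (child {r} {j} v j<) = child (Iso-valid {T} {p} {q} I v) (subst (λ x → j < arity x) (I r v) j<)

  Iso-trans : ∀ {T p q s} → Iso T p q → Iso T q s → Iso T p s
  Iso-trans {T} {p} {q} I J r v = trans (I r v) (J r (Iso-valid {T} {p} {q} I v))

  Iso-child : ∀ {T p q i} → Iso T p q → i < arity (T p) → Iso T (p ++ [ i ]) (q ++ [ i ])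
  Iso-child {T} {p} {q} {i} I i< r v =
    subst₂ (λ x y → T x ≡ T y) (sym (++-assoc p [ i ] r)) (sym (++-assoc q [ i ] r)) (I (i ∷ r) v′)
    where
    v′ : Valid (subtree T p) (i ∷ r)
    v′ = valid-++ {subtree T p} {[ i ]}
           (child root (subst (λ x → i < arity (T x)) (sym (++-identityʳ p)) i<))
           (valid-ext (λ x → cong T (++-assoc p [ i ] x)) v)

module Unfolding {L S : Set} (arity : L → ℕ) (δ : S → ℕ → S) (out : S → L) where
  open Trees arity

  run : S → Pos → S
  run s []      = s
  run s (i ∷ p) = run (δ s i) p

  run-++ : ∀ s p r → run s (p ++ r) ≡ run (run s p) r
  run-++ s []      r = refl
  run-++ s (i ∷ p) r = run-++ (δ s i) p r

  unfold : S → Pos → L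
  unfold s p = out (run s p)

  run-cong : ∀ s p q r → run s p ≡ run s q → run s (p ++ r) ≡ run s (q ++ r)
  run-cong s p q r e = begin
    run s (p ++ r)   ≡⟨ run-++ s p r ⟩
    run (run s p) r  ≡⟨ cong (λ t → run t r) e ⟩
    run (run s q) r  ≡⟨ run-++ s q r ⟨
    run s (q ++ r)   ∎

  module _ (_≟ₛ_ : DecidableEquality S) (s₀ : S) (U : List S)
           (reachable⊆U : ∀ p → Valid (unfold s₀) p → run s₀ p ∈ U) where
    open DecMembership _≟ₛ_ using (_∈?_)

    private
      T : Pos → L
      T = unfold s₀

      state : Pos → S
      state = run s₀

    children : Pos → List Pos
    children w = map (λ i → w ++ [ i ]) (upTo (arity (T w)))

    frontier : List Pos → List Pos
    frontier = concatMap children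

    ∈-frontier⁺ : ∀ {W w i} → w ∈ W → i < arity (T w) → w ++ [ i ] ∈ frontier W
    ∈-frontier⁺ {w = w} w∈ i< = ∈-concatMap⁺ children (lose w∈ (∈-map⁺ (λ j → w ++ [ j ]) (∈-upTo⁺ i<)))

    ∈-frontier⁻ : ∀ W {c} → c ∈ frontier W → ∃[ w ] ∃[ i ] (w ∈ W × i < arity (T w) × c ≡ w ++ [ i ])
    ∈-frontier⁻ (w ∷ W) c∈ with ∈-++⁻ (children w) c∈
    ... | inj₁ c∈′ = let i , i∈ , c≡ = ∈-map⁻ (λ j → w ++ [ j ]) c∈′ in w , i , here refl , ∈-upTo⁻ i∈ , c≡
    ... | inj₂ c∈′ = let w′ , i , w∈ , i< , c≡ = ∈-frontier⁻ W c∈′ in w′ , i , there w∈ , i< , c≡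

    Covers : List Pos → Set
    Covers W = ∀ p → Valid T p → ∃[ w ] (w ∈ W × state p ≡ state w)

    closed⇒covers : ∀ W → [] ∈ W → All (λ c → state c ∈ map state W) (frontier W) → Covers W
    closed⇒covers W []∈ closed .[] root = [] , []∈ , refl
    closed⇒covers W []∈ closed .(p ++ [ i ]) (child {p} {i} v i<)
      with w , w∈ , p≈w ← closed⇒covers W []∈ closed p v
      with w′ , w′∈ , c≈w′ ← ∈-map⁻ state
                               (All.lookup closed (∈-frontier⁺ w∈ (subst (λ x → i < arity x) (cong out p≈w) i<)))
      = w′ , w′∈ , trans (run-cong s₀ p w [ i ] p≈w) c≈w′

    -- Each round adds a child whose state is new; since all states lie in U,
    -- length U rounds suffice.
    explore : ∀ fuel W → All (Valid T) W → [] ∈ W → Unique (map state W) → length U < length W + fuel →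
              ∃[ W ] (All (Valid T) W × Covers W)
    explore zero W valid []∈ unique U< = ⊥-elim (<-irrefl refl (≤-<-trans W≤U (subst (length U <_) (+-identityʳ _) U<)))
      where
      W≤U : length W ≤ length U
      W≤U = subst (_≤ length U) (length-map state W)
              (Unique⊆⇒length≤ unique λ s∈ → let w , w∈ , s≡ = ∈-map⁻ state s∈ in
                 subst (_∈ U) (sym s≡) (reachable⊆U w (All.lookup valid w∈)))
    explore (suc fuel) W valid []∈ unique U<
      with All.all? (λ c → state c ∈? map state W) (frontier W)
    ... | yes closed = W , valid , closed⇒covers W []∈ closed
    ... | no ¬closed
      with c , c∈ , new ← find (¬All⇒Any¬ (λ c → state c ∈? map state W) (frontier W) ¬closed)
      with w , i , w∈ , i< , refl ← ∈-frontier⁻ W c∈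
      = explore fuel (c ∷ W) (child (All.lookup valid w∈) i< ∷ valid) (there []∈)
          (¬Any⇒All¬ (map state W) new ∷ unique) (subst (length U <_) (+-suc (length W) fuel) U<)

    unfold-regular : Regular T
    unfold-regular with W , valid , covers ← explore (length U) [ [] ] (root ∷ []) (here refl) ([] ∷ []) ≤-refl =
      W , (λ _ w∈ → All.lookup valid w∈) ,
      λ p v → let w , w∈ , p≈w = covers p v in w , w∈ , λ r _ → cong out (run-cong s₀ p w r p≈w)

-- Labelling the root sequent

label : Bool → ℕ → ℕ
label false c = c * 2
label true  c = suc (c * 2)

label-pol : ∀ b c → LabPol b (label b c)
label-pol false c = m*n%n≡0 c 2
label-pol true  c = [m+kn]%n≡m%n 1 c 2

label-≥ : ∀ b c → c * 2 ≤ label b c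
label-≥ false c = ≤-refl
label-≥ true  c = n≤1+n _

label-< : ∀ b c → label b c < suc c * 2
label-< false c = n≤1+n _
label-< true  c = ≤-refl

*2-mono : ∀ {m n} → m ≤ n → m * 2 ≤ n * 2
*2-mono = *-monoˡ-≤ 2

-- The c-th modal occurrence, counted left to right, gets label 2c or 2c+1
-- according to its polarity b; next c F is the counter after F.
next : ℕ → Fm → ℕ
next c (var _)  = c
next c bot      = c
next c (A ⇒ B)  = next (next c A) B
next c (□ A)    = next (suc c) A
next c (□⁺ A)   = next (suc c) A

annotate : Bool → ℕ → Fm → AFm
annotate b c (var p)  = avar p
annotate b c bot      = abot
annotate b c (A ⇒ B)  = annotate (not b) c A a⇒ annotate b (next c A) B
annotate b c (□ A)    = a□ (label b c) (annotate b (suc c) A)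
annotate b c (□⁺ A)   = a□⁺ (label b c) (annotate b (suc c) A)

nextAll : ℕ → List Fm → ℕ
nextAll c []       = c
nextAll c (F ∷ Fs) = nextAll (next c F) Fs

annotateAll : Bool → ℕ → List Fm → List AFm
annotateAll b c []       = []
annotateAll b c (F ∷ Fs) = annotate b c F ∷ annotateAll b (next c F) Fs

next-≥ : ∀ c F → c ≤ next c F
next-≥ c (var _)  = ≤-refl
next-≥ c bot      = ≤-refl
next-≥ c (A ⇒ B)  = ≤-trans (next-≥ c A) (next-≥ (next c A) B)
next-≥ c (□ A)    = ≤-trans (n≤1+n c) (next-≥ (suc c) A)
next-≥ c (□⁺ A)   = ≤-trans (n≤1+n c) (next-≥ (suc c) A)

nextAll-≥ : ∀ c Fs → c ≤ nextAll c Fs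
nextAll-≥ c []       = ≤-refl
nextAll-≥ c (F ∷ Fs) = ≤-trans (next-≥ c F) (nextAll-≥ (next c F) Fs)

erase-annotate : ∀ b c F → erase (annotate b c F) ≡ F
erase-annotate b c (var p)  = refl
erase-annotate b c bot      = refl
erase-annotate b c (A ⇒ B)  = cong₂ _⇒_ (erase-annotate (not b) c A) (erase-annotate b (next c A) B)
erase-annotate b c (□ A)    = cong □ (erase-annotate b (suc c) A)
erase-annotate b c (□⁺ A)   = cong □⁺ (erase-annotate b (suc c) A)

erase-annotateAll : ∀ b c Fs → map erase (annotateAll b c Fs) ≡ Fs
erase-annotateAll b c []       = refl
erase-annotateAll b c (F ∷ Fs) = cong₂ _∷_ (erase-annotate b c F) (erase-annotateAll b (next c F) Fs)

pol-annotate : ∀ b c F → Pol b (annotate b c F)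
pol-annotate b c (var p)  = tt
pol-annotate b c bot      = tt
pol-annotate b c (A ⇒ B)  = pol-annotate (not b) c A , pol-annotate b (next c A) B
pol-annotate b c (□ A)    = label-pol b c , pol-annotate b (suc c) A
pol-annotate b c (□⁺ A)   = label-pol b c , pol-annotate b (suc c) A

pol-annotateAll : ∀ b c Fs → All (Pol b) (annotateAll b c Fs)
pol-annotateAll b c []       = []
pol-annotateAll b c (F ∷ Fs) = pol-annotate b c F ∷ pol-annotateAll b (next c F) Fs

LabelsBelow : ℕ → AFm → Set
LabelsBelow K (avar _)   = ⊤
LabelsBelow K abot       = ⊤
LabelsBelow K (A a⇒ B)   = LabelsBelow K A × LabelsBelow K B
LabelsBelow K (a□ i A)   = i < K × LabelsBelow K A
LabelsBelow K (a□⁺ i A)  = i < K × LabelsBelow K A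

LabelsBelow-mono : ∀ {K K′} → K ≤ K′ → ∀ x → LabelsBelow K x → LabelsBelow K′ x
LabelsBelow-mono K≤ (avar _)   _         = tt
LabelsBelow-mono K≤ abot       _         = tt
LabelsBelow-mono K≤ (A a⇒ B)   (bA , bB) = LabelsBelow-mono K≤ A bA , LabelsBelow-mono K≤ B bB
LabelsBelow-mono K≤ (a□ i A)   (i< , bA) = <-≤-trans i< K≤ , LabelsBelow-mono K≤ A bA
LabelsBelow-mono K≤ (a□⁺ i A)  (i< , bA) = <-≤-trans i< K≤ , LabelsBelow-mono K≤ A bA

annotate-below : ∀ b c F → LabelsBelow (next c F * 2) (annotate b c F)
annotate-below b c (var p)  = tt
annotate-below b c bot      = tt
annotate-below b c (A ⇒ B)  =
  LabelsBelow-mono (*2-mono (next-≥ (next c A) B)) _ (annotate-below (not b) c A) , annotate-below b (next c A) B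
annotate-below b c (□ A)    = <-≤-trans (label-< b c) (*2-mono (next-≥ (suc c) A)) , annotate-below b (suc c) A
annotate-below b c (□⁺ A)   = <-≤-trans (label-< b c) (*2-mono (next-≥ (suc c) A)) , annotate-below b (suc c) A

annotateAll-below : ∀ b c Fs → All (LabelsBelow (nextAll c Fs * 2)) (annotateAll b c Fs)
annotateAll-below b c []       = []
annotateAll-below b c (F ∷ Fs) =
  LabelsBelow-mono (*2-mono (nextAll-≥ (next c F) Fs)) _ (annotate-below b c F) ∷ annotateAll-below b (next c F) Fs

IncreasingIn : ℕ → ℕ → List ℕ → Set
IncreasingIn lo hi xs = AllPairs _<_ xs × All (λ l → lo ≤ l × l < hi) xs

[]-increasing : ∀ {lo hi} → IncreasingIn lo hi []
[]-increasing = [] , []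

increasing-widen : ∀ {lo′ lo hi xs} → lo′ ≤ lo → IncreasingIn lo hi xs → IncreasingIn lo′ hi xs
increasing-widen lo′≤ (inc , range) = inc , All.map (λ (lo≤ , <hi) → ≤-trans lo′≤ lo≤ , <hi) range

∷-increasing : ∀ {lo mid hi i xs} → lo ≤ i → i < mid → mid ≤ hi → IncreasingIn mid hi xs → IncreasingIn lo hi (i ∷ xs)
∷-increasing lo≤i i<mid mid≤hi (inc , range) =
  All.map (λ (mid≤ , _) → <-≤-trans i<mid mid≤) range ∷ inc ,
  (lo≤i , <-≤-trans i<mid mid≤hi) ∷ proj₂ (increasing-widen (≤-trans lo≤i (<⇒≤ i<mid)) (inc , range))

++-increasing : ∀ {lo mid hi xs ys} → lo ≤ mid → mid ≤ hi →
                IncreasingIn lo mid xs → IncreasingIn mid hi ys → IncreasingIn lo hi (xs ++ ys)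
++-increasing lo≤mid mid≤hi (incx , rangex) (incy , rangey) =
  AllPairs.++⁺ incx incy (All.map (λ (_ , <mid) → All.map (λ (mid≤ , _) → <-≤-trans <mid mid≤) rangey) rangex) ,
  All.++⁺ (All.map (λ (lo≤ , <mid) → lo≤ , <-≤-trans <mid mid≤hi) rangex)
          (All.map (λ (mid≤ , <hi) → ≤-trans lo≤mid mid≤ , <hi) rangey)

annotate-increasing : ∀ b c F →
  IncreasingIn (c * 2) (next c F * 2) (boxLabs (annotate b c F)) × IncreasingIn (c * 2) (next c F * 2) (boxpLabs (annotate b c F))
annotate-increasing b c (var p)  = []-increasing , []-increasing
annotate-increasing b c bot      = []-increasing , []-increasing
annotate-increasing b c (A ⇒ B)  =
  let incA₁ , incA₂ = annotate-increasing (not b) c A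
      incB₁ , incB₂ = annotate-increasing b (next c A) B
      c≤ = *2-mono (next-≥ c A)
      ≤n = *2-mono (next-≥ (next c A) B)
  in ++-increasing c≤ ≤n incA₁ incB₁ , ++-increasing c≤ ≤n incA₂ incB₂
annotate-increasing b c (□ A)    =
  let inc₁ , inc₂ = annotate-increasing b (suc c) A
  in ∷-increasing (label-≥ b c) (label-< b c) (*2-mono (next-≥ (suc c) A)) inc₁ , increasing-widen (*2-mono (n≤1+n c)) inc₂
annotate-increasing b c (□⁺ A)   =
  let inc₁ , inc₂ = annotate-increasing b (suc c) A
  in increasing-widen (*2-mono (n≤1+n c)) inc₁ , ∷-increasing (label-≥ b c) (label-< b c) (*2-mono (next-≥ (suc c) A)) inc₂

annotateAll-increasing : ∀ b c Fs →
  IncreasingIn (c * 2) (nextAll c Fs * 2) (concatMap boxLabs (annotateAll b c Fs))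
  × IncreasingIn (c * 2) (nextAll c Fs * 2) (concatMap boxpLabs (annotateAll b c Fs))
annotateAll-increasing b c []       = []-increasing , []-increasing
annotateAll-increasing b c (F ∷ Fs) =
  let incF₁ , incF₂ = annotate-increasing b c F
      incFs₁ , incFs₂ = annotateAll-increasing b (next c F) Fs
      c≤ = *2-mono (next-≥ c F)
      ≤n = *2-mono (nextAll-≥ (next c F) Fs)
  in ++-increasing c≤ ≤n incF₁ incFs₁ , ++-increasing c≤ ≤n incF₂ incFs₂

_≟ᴬ_ : DecidableEquality AFm
avar p    ≟ᴬ avar q     = map′ (cong avar) (λ { refl → refl }) (p ≟ q)
abot      ≟ᴬ abot       = yes refl
(A a⇒ B)  ≟ᴬ (A′ a⇒ B′) = map′ (λ { (refl , refl) → refl }) (λ { refl → refl , refl }) (A ≟ᴬ A′ ×-dec B ≟ᴬ B′)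
a□ i A    ≟ᴬ a□ j B     = map′ (λ { (refl , refl) → refl }) (λ { refl → refl , refl }) (i ≟ j ×-dec A ≟ᴬ B)
a□⁺ i A   ≟ᴬ a□⁺ j B    = map′ (λ { (refl , refl) → refl }) (λ { refl → refl , refl }) (i ≟ j ×-dec A ≟ᴬ B)
avar _    ≟ᴬ abot       = no λ ()
avar _    ≟ᴬ (_ a⇒ _)   = no λ ()
avar _    ≟ᴬ a□ _ _     = no λ ()
avar _    ≟ᴬ a□⁺ _ _    = no λ ()
abot      ≟ᴬ avar _     = no λ ()
abot      ≟ᴬ (_ a⇒ _)   = no λ ()
abot      ≟ᴬ a□ _ _     = no λ ()
abot      ≟ᴬ a□⁺ _ _    = no λ ()
(_ a⇒ _)  ≟ᴬ avar _     = no λ ()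
(_ a⇒ _)  ≟ᴬ abot       = no λ ()
(_ a⇒ _)  ≟ᴬ a□ _ _     = no λ ()
(_ a⇒ _)  ≟ᴬ a□⁺ _ _    = no λ ()
a□ _ _    ≟ᴬ avar _     = no λ ()
a□ _ _    ≟ᴬ abot       = no λ ()
a□ _ _    ≟ᴬ (_ a⇒ _)   = no λ ()
a□ _ _    ≟ᴬ a□⁺ _ _    = no λ ()
a□⁺ _ _   ≟ᴬ avar _     = no λ ()
a□⁺ _ _   ≟ᴬ abot       = no λ ()
a□⁺ _ _   ≟ᴬ (_ a⇒ _)   = no λ ()
a□⁺ _ _   ≟ᴬ a□ _ _     = no λ ()

_≟ᶠ_ : DecidableEquality Fm
F ≟ᶠ G = map′ (λ e → trans (sym (erase-annotate false 0 F)) (trans (cong erase e) (erase-annotate false 0 G)))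
              (cong (annotate false 0)) (annotate false 0 F ≟ᴬ annotate false 0 G)

_≟ᵃ_ : DecidableEquality ASeq
aseq Γ Δ α ≟ᵃ aseq Γ′ Δ′ α′ =
  map′ (λ { (refl , refl , refl) → refl }) (λ { refl → refl , refl , refl })
       (List.≡-dec _≟ᴬ_ Γ Γ′ ×-dec List.≡-dec _≟ᴬ_ Δ Δ′ ×-dec Maybe.≡-dec (Product.≡-dec _≟_ _≟ᴬ_) α α′)

module Reorder {A B : Set} (f : A → B) (_≟ᴮ_ : DecidableEquality B) where

  pick : B → List A → Maybe (A × List A)
  pick y []       = nothing
  pick y (x ∷ xs) with f x ≟ᴮ y
  ... | yes _ = just (x , xs)
  ... | no _  = Maybe.map (λ (z , zs) → z , x ∷ zs) (pick y xs)

  pick-∈ : ∀ {y} xs → y ∈ map f xs → ∃[ z ] ∃[ zs ] (pick y xs ≡ just (z , zs) × f z ≡ y × xs ↭ z ∷ zs)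
  pick-∈ {y} (x ∷ xs) y∈ with f x ≟ᴮ y | y∈
  ... | yes fx≡y | _           = x , xs , refl , fx≡y , ↭-refl
  ... | no fx≢y  | here y≡fx   = ⊥-elim (fx≢y (sym y≡fx))
  ... | no _     | there y∈xs
    with pick y xs | pick-∈ xs y∈xs
  ... | .(just (z , zs)) | z , zs , refl , fz≡y , xs↭ =
    z , x ∷ zs , refl , fz≡y , ↭-trans (↭-prep x xs↭) (↭-swap x z ↭-refl)

  reorder : List A → List B → List A
  reorder xs []       = []
  reorder xs (y ∷ ys) with pick y xs
  ... | nothing       = []
  ... | just (z , zs) = z ∷ reorder zs ys

  pick-↭ : ∀ {y ys} xs → map f xs ↭ y ∷ ys →
           ∃[ z ] ∃[ zs ] (pick y xs ≡ just (z , zs) × f z ≡ y × map f zs ↭ ys × xs ↭ z ∷ zs)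
  pick-↭ {y} {ys} xs p with z , zs , eq , fz≡y , xs↭ ← pick-∈ xs (∈-resp-↭ (↭-sym p) (here refl)) =
    z , zs , eq , fz≡y , drop-∷ (subst (λ w → w ∷ map f zs ↭ y ∷ ys) fz≡y (↭-trans (↭-sym (map⁺ f xs↭)) p)) , xs↭

  reorder-fits : ∀ xs ys → map f xs ↭ ys → map f (reorder xs ys) ≡ ys × xs ↭ reorder xs ys
  reorder-fits []       []       _ = refl , ↭-refl
  reorder-fits (x ∷ xs) []       p with () ← ↭-empty-inv p
  reorder-fits xs       (y ∷ ys) p with z , zs , eq , fz≡y , zs↭ , xs↭ ← pick-↭ xs p rewrite eq
    with e , zs↭′ ← reorder-fits zs ys zs↭ = cong₂ _∷_ fz≡y e , ↭-trans xs↭ (↭-prep z zs↭′)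

WellLabelled : Bool → ℕ → AFm → Set
WellLabelled b K x = Pol b x × LabelsBelow K x

SubIn : Maybe (ℕ × AFm) → List AFm → Set
SubIn α Δ = ∀ n C → α ≡ just (n , C) → a□⁺ n C ∈ Δ

-- K bounds every label, so that along a regular proof only finitely many
-- annotated sequents occur.
record Annotates (K : ℕ) (a : ASeq) (s : Seq) : Set where
  constructor annotates
  field
    ant-erases  : map erase (ASeq.ant a) ≡ Seq.ant s
    succ-erases : map erase (ASeq.succ a) ≡ Seq.succ s
    sub∈succ    : SubIn (ASeq.sub a) (ASeq.succ a)
    ant-ok      : All (WellLabelled false K) (ASeq.ant a)
    succ-ok     : All (WellLabelled true K) (ASeq.succ a)

infix 4 _↭ᵉ_

_↭ᵉ_ : List AFm → List Fm → Set
Xs ↭ᵉ Fs = map erase Xs ↭ Fs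

open Reorder erase _≟ᶠ_

-- Premises are computed from the annotated conclusion alone, without the
-- invariant, because the automaton defining the annotated proof sees nothing else.
fit : List AFm → List AFm → Maybe (ℕ × AFm) → Seq → ASeq
fit Γ Δ α s = aseq (reorder Γ (Seq.ant s)) (reorder Δ (Seq.succ s)) α

Fits : ℕ → List AFm → List AFm → Maybe (ℕ × AFm) → Seq → Set
Fits K Γ Δ α s = fit Γ Δ α s ≈A aseq Γ Δ α × Annotates K (fit Γ Δ α s) s

fit-annotates : ∀ {K Γ Δ α} s → Γ ↭ᵉ Seq.ant s → Δ ↭ᵉ Seq.succ s → SubIn α Δ →
                All (WellLabelled false K) Γ → All (WellLabelled true K) Δ → Fits K Γ Δ α s
fit-annotates {Γ = Γ} {Δ} s Γ↭ Δ↭ α∈Δ okΓ okΔ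
  with eΓ , pΓ ← reorder-fits Γ (Seq.ant s) Γ↭
  with eΔ , pΔ ← reorder-fits Δ (Seq.succ s) Δ↭ =
  (↭-sym pΓ , ↭-sym pΔ , refl) ,
  annotates eΓ eΔ (λ n C e → ∈-resp-↭ pΔ (α∈Δ n C e)) (All-resp-↭ pΓ okΓ) (All-resp-↭ pΔ okΔ)

-- Junk value (abot , []) when F does not occur in Xs.
principal : Fm → List AFm → AFm × List AFm
principal F Xs = Maybe.fromMaybe (abot , []) (pick F Xs)

principal-fits : ∀ {F Fs} Xs → Xs ↭ᵉ F ∷ Fs →
                 let x , rest = principal F Xs in erase x ≡ F × rest ↭ᵉ Fs × Xs ↭ x ∷ rest
principal-fits Xs p with z , zs , eq , e , zs↭ , Xs↭ ← pick-↭ Xs p rewrite eq = e , zs↭ , Xs↭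

∷-↭ᵉ : ∀ {x F Xs Fs} → erase x ≡ F → Xs ↭ᵉ Fs → x ∷ Xs ↭ᵉ F ∷ Fs
∷-↭ᵉ refl Xs↭ = ↭-prep _ Xs↭

-- Partial inverses of the annotated connectives, with junk values on other formulas.
unimp : AFm → AFm × AFm
unimp (A a⇒ B) = A , B
unimp x        = x , x

unbox : AFm → ℕ × AFm
unbox (a□ i A) = i , A
unbox x        = 0 , x

unboxp : AFm → ℕ × AFm
unboxp (a□⁺ i A) = i , A
unboxp x         = 0 , x

erase≡var : ∀ x {p} → erase x ≡ var p → x ≡ avar p
erase≡var (avar _) refl = refl

erase≡bot : ∀ x → erase x ≡ bot → x ≡ abot
erase≡bot abot      refl = refl

erase≡⇒ : ∀ x {A B} → erase x ≡ A ⇒ B →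
          x ≡ proj₁ (unimp x) a⇒ proj₂ (unimp x) × erase (proj₁ (unimp x)) ≡ A × erase (proj₂ (unimp x)) ≡ B
erase≡⇒ (_ a⇒ _)  refl = refl , refl , refl

erase≡□ : ∀ x {A} → erase x ≡ □ A → x ≡ boxL (unbox x) × erase (proj₂ (unbox x)) ≡ A
erase≡□ (a□ _ _)  refl = refl , refl

erase≡□⁺ : ∀ x {A} → erase x ≡ □⁺ A → x ≡ boxpL (unboxp x) × erase (proj₂ (unboxp x)) ≡ A
erase≡□⁺ (a□⁺ _ _) refl = refl , refl

map-erase≡map□ : ∀ L {Sg} → map erase L ≡ map □ Sg →
                 L ≡ map boxL (map unbox L) × map erase (map proj₂ (map unbox L)) ≡ Sg
map-erase≡map□ []      {[]}    _ = refl , refl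
map-erase≡map□ (x ∷ L) {_ ∷ _} e with ex , eL ← ∷-injective e
  with x≡ , eA ← erase≡□ x ex with L≡ , eSg ← map-erase≡map□ L eL = cong₂ _∷_ x≡ L≡ , cong₂ _∷_ eA eSg

map-erase≡map□⁺ : ∀ L {Pi} → map erase L ≡ map □⁺ Pi →
                  L ≡ map boxpL (map unboxp L) × map erase (map proj₂ (map unboxp L)) ≡ Pi
map-erase≡map□⁺ []      {[]}    _ = refl , refl
map-erase≡map□⁺ (x ∷ L) {_ ∷ _} e with ex , eL ← ∷-injective e
  with x≡ , eA ← erase≡□⁺ x ex with L≡ , ePi ← map-erase≡map□⁺ L eL = cong₂ _∷_ x≡ L≡ , cong₂ _∷_ eA ePi

wl-⇒ˡ : ∀ {b K A B} → WellLabelled b K (A a⇒ B) → WellLabelled (not b) K A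
wl-⇒ˡ ((pA , _) , (bA , _)) = pA , bA

wl-⇒ʳ : ∀ {b K A B} → WellLabelled b K (A a⇒ B) → WellLabelled b K B
wl-⇒ʳ ((_ , pB) , (_ , bB)) = pB , bB

wl-□ : ∀ {b K i A} → WellLabelled b K (a□ i A) → WellLabelled b K A
wl-□ ((_ , p) , (_ , bA)) = p , bA

wl-□⁺ : ∀ {b K i A} → WellLabelled b K (a□⁺ i A) → WellLabelled b K A
wl-□⁺ ((_ , p) , (_ , bA)) = p , bA

module ModalSplit (Γa : List AFm) (Υ Sg Pi : List Fm) where

  ordered : List AFm
  ordered = reorder Γa (Υ ++ map □ Sg ++ map □⁺ Pi)

  boxed : List AFm
  boxed = drop (length Υ) ordered

  Υa : List AFm
  Υa = take (length Υ) ordered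

  Σa : List (ℕ × AFm)
  Σa = map unbox (take (length Sg) boxed)

  Πa : List (ℕ × AFm)
  Πa = map unboxp (drop (length Sg) boxed)

  premiseAnt : List AFm
  premiseAnt = map proj₂ Σa ++ map proj₂ Πa ++ map boxpL Πa

  module _ {K} (Γa↭ : Γa ↭ᵉ Υ ++ map □ Sg ++ map □⁺ Pi) (okΓa : All (WellLabelled false K) Γa) where

    private
      ordered-fits : map erase ordered ≡ Υ ++ map □ Sg ++ map □⁺ Pi × Γa ↭ ordered
      ordered-fits = reorder-fits Γa (Υ ++ map □ Sg ++ map □⁺ Pi) Γa↭

      boxed-erases : map erase boxed ≡ map □ Sg ++ map □⁺ Pi
      boxed-erases = proj₂ (map-≡-++⁻ erase ordered Υ _ refl (proj₁ ordered-fits))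

      Σ-view : take (length Sg) boxed ≡ map boxL Σa × map erase (map proj₂ Σa) ≡ Sg
      Σ-view = map-erase≡map□ _ (proj₁ (map-≡-++⁻ erase boxed (map □ Sg) (map □⁺ Pi) (length-map □ Sg) boxed-erases))

      Π-view : drop (length Sg) boxed ≡ map boxpL Πa × map erase (map proj₂ Πa) ≡ Pi
      Π-view = map-erase≡map□⁺ _ (proj₂ (map-≡-++⁻ erase boxed (map □ Sg) (map □⁺ Pi) (length-map □ Sg) boxed-erases))

      erase-boxpL : ∀ Xs → map erase (map boxpL Xs) ≡ map □⁺ (map erase (map proj₂ Xs))
      erase-boxpL []       = refl
      erase-boxpL (_ ∷ Xs) = cong (_ ∷_) (erase-boxpL Xs)

      bodies : ∀ {m : ℕ × AFm → AFm} → (∀ {y} → WellLabelled false K (m y) → WellLabelled false K (proj₂ y)) →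
               ∀ Ys → All (WellLabelled false K) (map m Ys) → All (WellLabelled false K) (map proj₂ Ys)
      bodies body []       []         = []
      bodies body (_ ∷ Ys) (ok ∷ oks) = body ok ∷ bodies body Ys oks

    split-↭ : Γa ↭ Υa ++ map boxL Σa ++ map boxpL Πa
    split-↭ = ↭-trans (proj₂ ordered-fits) (↭-reflexive (begin
      ordered                                                 ≡⟨ take++drop≡id (length Υ) ordered ⟨
      Υa ++ boxed                                             ≡⟨ cong (Υa ++_) (take++drop≡id (length Sg) boxed) ⟨
      Υa ++ take (length Sg) boxed ++ drop (length Sg) boxed  ≡⟨ cong (Υa ++_) (cong₂ _++_ (proj₁ Σ-view) (proj₁ Π-view)) ⟩
      Υa ++ map boxL Σa ++ map boxpL Πa                       ∎))

    premiseAnt-erases : premiseAnt ↭ᵉ Sg ++ Pi ++ map □⁺ Pi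
    premiseAnt-erases = ↭-reflexive (begin
      map erase premiseAnt
        ≡⟨ map-++ erase (map proj₂ Σa) _ ⟩
      map erase (map proj₂ Σa) ++ map erase (map proj₂ Πa ++ map boxpL Πa)
        ≡⟨ cong₂ _++_ (proj₂ Σ-view) (map-++ erase (map proj₂ Πa) _) ⟩
      Sg ++ map erase (map proj₂ Πa) ++ map erase (map boxpL Πa)
        ≡⟨ cong (Sg ++_) (cong₂ _++_ (proj₂ Π-view) (trans (erase-boxpL Πa) (cong (map □⁺) (proj₂ Π-view)))) ⟩
      Sg ++ Pi ++ map □⁺ Pi
        ∎)

    premiseAnt-ok : All (WellLabelled false K) premiseAnt
    premiseAnt-ok = All.++⁺ (bodies wl-□ Σa Σ-ok) (All.++⁺ (bodies wl-□⁺ Πa Π-ok) Π-ok)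
      where
      boxes-ok : All (WellLabelled false K) (map boxL Σa ++ map boxpL Πa)
      boxes-ok = All.++⁻ʳ Υa (All-resp-↭ split-↭ okΓa)
      Σ-ok : All (WellLabelled false K) (map boxL Σa)
      Σ-ok = All.++⁻ˡ (map boxL Σa) boxes-ok
      Π-ok : All (WellLabelled false K) (map boxpL Πa)
      Π-ok = All.++⁻ʳ (map boxL Σa) boxes-ok

boxIn : Fm → List AFm → ℕ × AFm
boxIn A Δa = unbox (proj₁ (principal (□ A) Δa))

boxpIn : Fm → List AFm → ℕ × AFm
boxpIn A Δa = unboxp (proj₁ (principal (□⁺ A) Δa))

-- The subscript is reused as principal formula whenever it fits, which keeps
-- it constant along a branch.
boxpPrincipal : Maybe (ℕ × AFm) → Fm → List AFm → ℕ × AFm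
boxpPrincipal nothing        A Δa = boxpIn A Δa
boxpPrincipal (just (n , C)) A Δa with erase C ≟ᶠ A
... | yes _ = n , C
... | no _  = boxpIn A Δa

boxIn-fits : ∀ {A Λ} Δa → Δa ↭ᵉ □ A ∷ Λ → boxL (boxIn A Δa) ∈ Δa × erase (proj₂ (boxIn A Δa)) ≡ A
boxIn-fits Δa Δa↭ with ex , _ , Δa↭′ ← principal-fits Δa Δa↭ with x≡ , eA ← erase≡□ _ ex =
  ∈-resp-↭ (↭-sym Δa↭′) (here (sym x≡)) , eA

boxpIn-fits : ∀ {A Λ} Δa → Δa ↭ᵉ □⁺ A ∷ Λ → boxpL (boxpIn A Δa) ∈ Δa × erase (proj₂ (boxpIn A Δa)) ≡ A
boxpIn-fits Δa Δa↭ with ex , _ , Δa↭′ ← principal-fits Δa Δa↭ with x≡ , eA ← erase≡□⁺ _ ex =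
  ∈-resp-↭ (↭-sym Δa↭′) (here (sym x≡)) , eA

boxpPrincipal-fits : ∀ {A Λ} α Δa → Δa ↭ᵉ □⁺ A ∷ Λ → SubIn α Δa →
                     boxpL (boxpPrincipal α A Δa) ∈ Δa × erase (proj₂ (boxpPrincipal α A Δa)) ≡ A
boxpPrincipal-fits nothing Δa Δa↭ _ = boxpIn-fits Δa Δa↭
boxpPrincipal-fits {A} (just (n , C)) Δa Δa↭ α∈ with erase C ≟ᶠ A
... | yes eC = α∈ n C refl , eC
... | no _   = boxpIn-fits Δa Δa↭

boxpPrincipal-sub : ∀ {n C A} Δa → erase C ≡ A → boxpPrincipal (just (n , C)) A Δa ≡ (n , C)
boxpPrincipal-sub {C = C} {A} Δa eC with erase C ≟ᶠ A
... | yes _  = refl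
... | no ¬eC = ⊥-elim (¬eC eC)

-- Annotating one rule application

annotatedRule : (s : Seq) (r : RuleS) (ch : ℕ → Seq) → StepS s r ch → ASeq → RuleA
annotatedRule s axp      ch _                   _              = aaxp
annotatedRule s ax⊥      ch _                   _              = aax⊥
annotatedRule s impL     ch _                   _              = aimpL
annotatedRule s impR     ch _                   _              = aimpR
annotatedRule s box      ch (A , _)             (aseq _ Δa _)  = abox (proj₁ (boxIn A Δa))
annotatedRule s (boxp A) ch _                   (aseq _ Δa α)  = let n , C = boxpPrincipal α A Δa in aboxp n C

-- Indices beyond the arity of the rule get junk premises.
annotatedPremise : (s : Seq) (r : RuleS) (ch : ℕ → Seq) → StepS s r ch → ASeq → ℕ → ASeq
annotatedPremise s axp ch _ a _ = a
annotatedPremise s ax⊥ ch _ a _ = a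
annotatedPremise s impL ch (A , B , _) (aseq Γa Δa α) zero =
  let x , rest = principal (A ⇒ B) Γa in fit (proj₂ (unimp x) ∷ rest) Δa α (ch 0)
annotatedPremise s impL ch (A , B , _) (aseq Γa Δa α) (suc _) =
  let x , rest = principal (A ⇒ B) Γa in fit rest (proj₁ (unimp x) ∷ Δa) α (ch 1)
annotatedPremise s impR ch (A , B , _) (aseq Γa Δa α) _ =
  let x , rest = principal (A ⇒ B) Δa in fit (proj₁ (unimp x) ∷ Γa) (proj₂ (unimp x) ∷ rest) α (ch 0)
annotatedPremise s box ch (A , Υ , Sg , Pi , _) (aseq Γa Δa α) _ =
  fit (ModalSplit.premiseAnt Γa Υ Sg Pi) [ proj₂ (boxIn A Δa) ] nothing (ch 0)
annotatedPremise s (boxp A) ch (Υ , Sg , Pi , _) (aseq Γa Δa α) zero =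
  fit (ModalSplit.premiseAnt Γa Υ Sg Pi) [ proj₂ (boxpPrincipal α A Δa) ] nothing (ch 0)
annotatedPremise s (boxp A) ch (Υ , Sg , Pi , _) (aseq Γa Δa α) (suc _) =
  fit (ModalSplit.premiseAnt Γa Υ Sg Pi) [ boxpL (boxpPrincipal α A Δa) ] (just (boxpPrincipal α A Δa)) (ch 1)

AnnotatesStep : ℕ → Seq → RuleS → (ℕ → Seq) → ASeq → RuleA → (ℕ → ASeq) → Set
AnnotatesStep K s r ch a r′ ch′ =
  StepA a r′ ch′ × eraseRule r′ ≡ r × (∀ i → i < arityS r → Annotates K (ch′ i) (ch i))

annotates-impL : ∀ {K s ch} (st : StepS s impL ch) a → Annotates K a s →
                 AnnotatesStep K s impL ch a aimpL (annotatedPremise s impL ch st a)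
annotates-impL {K} {ch = ch} (A , B , Γ , Δ , (sΓ , sΔ) , (c₀Γ , c₀Δ) , (c₁Γ , c₁Δ)) (aseq Γa Δa α)
               (annotates refl refl α∈ okΓ okΔ)
  with ex , rest↭ , Γa↭ ← principal-fits Γa sΓ
  with x≡ , eA , eB ← erase≡⇒ _ ex =
  (xA , xB , rest , Δa , α , (Γa↭′ , ↭-refl , refl) , proj₁ premise₀ , proj₁ premise₁) , refl , premises
  where
  x : AFm
  x = proj₁ (principal (A ⇒ B) Γa)
  rest : List AFm
  rest = proj₂ (principal (A ⇒ B) Γa)
  xA xB : AFm
  xA = proj₁ (unimp x)
  xB = proj₂ (unimp x)
  Γa↭′ : Γa ↭ (xA a⇒ xB) ∷ rest
  Γa↭′ = subst (λ y → Γa ↭ y ∷ rest) x≡ Γa↭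
  okx : WellLabelled false K (xA a⇒ xB)
  okx = All.head (All-resp-↭ Γa↭′ okΓ)
  okrest : All (WellLabelled false K) rest
  okrest = All.tail (All-resp-↭ Γa↭′ okΓ)
  premise₀ : Fits K (xB ∷ rest) Δa α (ch 0)
  premise₀ = fit-annotates (ch 0) (↭-trans (∷-↭ᵉ eB rest↭) (↭-sym c₀Γ)) (↭-trans sΔ (↭-sym c₀Δ))
               α∈ (wl-⇒ʳ okx ∷ okrest) okΔ
  premise₁ : Fits K rest (xA ∷ Δa) α (ch 1)
  premise₁ = fit-annotates (ch 1) (↭-trans rest↭ (↭-sym c₁Γ)) (↭-trans (∷-↭ᵉ eA sΔ) (↭-sym c₁Δ))
               (λ n C e → there (α∈ n C e)) okrest (wl-⇒ˡ okx ∷ okΔ)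
  premises : ∀ i → i < 2 → Annotates K (annotatedPremise _ impL ch (A , B , Γ , Δ , _) (aseq Γa Δa α) i) (ch i)
  premises zero       _ = proj₂ premise₀
  premises (suc zero) _ = proj₂ premise₁
  premises (suc (suc _)) (s≤s (s≤s ()))

annotates-impR : ∀ {K s ch} (st : StepS s impR ch) a → Annotates K a s →
                 AnnotatesStep K s impR ch a aimpR (annotatedPremise s impR ch st a)
annotates-impR {K} {ch = ch} (A , B , Γ , Δ , (sΓ , sΔ) , (c₀Γ , c₀Δ)) (aseq Γa Δa α) (annotates refl refl α∈ okΓ okΔ)
  with ex , rest↭ , Δa↭ ← principal-fits Δa sΔ
  with x≡ , eA , eB ← erase≡⇒ _ ex =
  (xA , xB , Γa , rest , α , (↭-refl , Δa↭′ , refl) , proj₁ premise₀) , refl ,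
  λ { zero _ → proj₂ premise₀ ; (suc _) (s≤s ()) }
  where
  x : AFm
  x = proj₁ (principal (A ⇒ B) Δa)
  rest : List AFm
  rest = proj₂ (principal (A ⇒ B) Δa)
  xA xB : AFm
  xA = proj₁ (unimp x)
  xB = proj₂ (unimp x)
  Δa↭′ : Δa ↭ (xA a⇒ xB) ∷ rest
  Δa↭′ = subst (λ y → Δa ↭ y ∷ rest) x≡ Δa↭
  okx : WellLabelled true K (xA a⇒ xB)
  okx = All.head (All-resp-↭ Δa↭′ okΔ)
  okrest : All (WellLabelled true K) rest
  okrest = All.tail (All-resp-↭ Δa↭′ okΔ)
  α∈rest : SubIn α rest
  α∈rest n C e with there C∈ ← ∈-resp-↭ Δa↭′ (α∈ n C e) = C∈
  premise₀ : Fits K (xA ∷ Γa) (xB ∷ rest) α (ch 0)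
  premise₀ = fit-annotates (ch 0) (↭-trans (∷-↭ᵉ eA sΓ) (↭-sym c₀Γ)) (↭-trans (∷-↭ᵉ eB rest↭) (↭-sym c₀Δ))
               (λ n C e → there (α∈rest n C e)) (wl-⇒ˡ okx ∷ okΓ) (wl-⇒ʳ okx ∷ okrest)

annotates-box : ∀ {K s ch} (st : StepS s box ch) a → Annotates K a s →
                AnnotatesStep K s box ch a (annotatedRule s box ch st a) (annotatedPremise s box ch st a)
annotates-box {K} {ch = ch} (A , Υ , Sg , Pi , _ , (sΓ , sΔ) , (c₀Γ , c₀Δ)) (aseq Γa Δa α) (annotates refl refl _ okΓ okΔ)
  with C∈ , eC ← boxIn-fits Δa sΔ
  with Λa , Δa↭ ← ∈⇒↭ C∈ =
  (C , Υa , Σa , Πa , Λa , α , (split-↭ sΓ okΓ , Δa↭ , refl) , proj₁ premise₀) , refl ,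
  λ { zero _ → proj₂ premise₀ ; (suc _) (s≤s ()) }
  where
  open ModalSplit Γa Υ Sg Pi
  C : AFm
  C = proj₂ (boxIn A Δa)
  premise₀ : Fits K premiseAnt [ C ] nothing (ch 0)
  premise₀ = fit-annotates (ch 0) (↭-trans (premiseAnt-erases sΓ okΓ) (↭-sym c₀Γ))
               (↭-trans (∷-↭ᵉ eC ↭-refl) (↭-sym c₀Δ))
               (λ _ _ ()) (premiseAnt-ok sΓ okΓ) (wl-□ (All.lookup okΔ C∈) ∷ [])

annotates-boxp : ∀ {K s A ch} (st : StepS s (boxp A) ch) a → Annotates K a s →
                 AnnotatesStep K s (boxp A) ch a (annotatedRule s (boxp A) ch st a) (annotatedPremise s (boxp A) ch st a)
annotates-boxp {K} {A = A} {ch} (Υ , Sg , Pi , _ , (sΓ , sΔ) , (c₀Γ , c₀Δ) , (c₁Γ , c₁Δ)) (aseq Γa Δa α)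
               (annotates refl refl α∈ okΓ okΔ)
  with C∈ , eC ← boxpPrincipal-fits α Δa sΔ α∈
  with Λa , Δa↭ ← ∈⇒↭ C∈ =
  (Υa , Σa , Πa , Λa , α , (split-↭ sΓ okΓ , Δa↭ , refl) , proj₁ premise₀ , proj₁ premise₁) , cong boxp eC , premises
  where
  open ModalSplit Γa Υ Sg Pi
  nC : ℕ × AFm
  nC = boxpPrincipal α A Δa
  okC : WellLabelled true K (boxpL nC)
  okC = All.lookup okΔ C∈
  premise₀ : Fits K premiseAnt [ proj₂ nC ] nothing (ch 0)
  premise₀ = fit-annotates (ch 0) (↭-trans (premiseAnt-erases sΓ okΓ) (↭-sym c₀Γ))
               (↭-trans (∷-↭ᵉ eC ↭-refl) (↭-sym c₀Δ))
               (λ _ _ ()) (premiseAnt-ok sΓ okΓ) (wl-□⁺ okC ∷ [])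
  premise₁ : Fits K premiseAnt [ boxpL nC ] (just nC) (ch 1)
  premise₁ = fit-annotates (ch 1) (↭-trans (premiseAnt-erases sΓ okΓ) (↭-sym c₁Γ))
               (↭-trans (∷-↭ᵉ {boxpL nC} {Xs = []} (cong □⁺ eC) ↭-refl) (↭-sym c₁Δ))
               (λ { _ _ refl → here refl }) (premiseAnt-ok sΓ okΓ) (okC ∷ [])
  premises : ∀ i → i < 2 → Annotates K (annotatedPremise _ (boxp A) ch (Υ , Sg , Pi , _) (aseq Γa Δa α) i) (ch i)
  premises zero       _ = proj₂ premise₀
  premises (suc zero) _ = proj₂ premise₁
  premises (suc (suc _)) (s≤s (s≤s ()))

annotatesStep : ∀ {K} s r ch (st : StepS s r ch) a → Annotates K a s →
                AnnotatesStep K s r ch a (annotatedRule s r ch st a) (annotatedPremise s r ch st a)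
annotatesStep s axp ch (p , _ , _ , sΓ , sΔ) (aseq Γa Δa α) (annotates refl refl _ _ _)
  with eΓ , _ , Γa↭ ← principal-fits Γa sΓ with eΔ , _ , Δa↭ ← principal-fits Δa sΔ =
  (p , _ , _ , α , subst (λ x → Γa ↭ x ∷ proj₂ (principal (var p) Γa)) (erase≡var _ eΓ) Γa↭ ,
                   subst (λ x → Δa ↭ x ∷ proj₂ (principal (var p) Δa)) (erase≡var _ eΔ) Δa↭ , refl) ,
  refl , λ _ ()
annotatesStep s ax⊥ ch (_ , _ , sΓ , _) (aseq Γa Δa α) (annotates refl refl _ _ _)
  with eΓ , _ , Γa↭ ← principal-fits Γa sΓ =
  (_ , Δa , α , subst (λ x → Γa ↭ x ∷ proj₂ (principal bot Γa)) (erase≡bot _ eΓ) Γa↭ , ↭-refl , refl) , refl , λ _ ()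
annotatesStep s impL     ch st = annotates-impL st
annotatesStep s impR     ch st = annotates-impR st
annotatesStep s box      ch st = annotates-box st
annotatesStep s (boxp A) ch st = annotates-boxp st

rootAnnotation : Seq → ASeq
rootAnnotation (Γ ⊢ Δ) = aseq (annotateAll false 0 Γ) (annotateAll true (nextAll 0 Γ) Δ) nothing

rootBound : Seq → ℕ
rootBound (Γ ⊢ Δ) = nextAll (nextAll 0 Γ) Δ * 2

rootAnnotation-annotates : ∀ s → Annotates (rootBound s) (rootAnnotation s) s
rootAnnotation-annotates (Γ ⊢ Δ) =
  annotates (erase-annotateAll false 0 Γ) (erase-annotateAll true _ Δ) (λ _ _ ())
    (All.zip (pol-annotateAll false 0 Γ , All.map (LabelsBelow-mono (*2-mono (nextAll-≥ _ Δ)) _) (annotateAll-below false 0 Γ)))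
    (All.zip (pol-annotateAll true _ Δ , annotateAll-below true _ Δ))

rootAnnotation-proper : ∀ s → ProperASeq (rootAnnotation s)
rootAnnotation-proper (Γ ⊢ Δ) =
  let incΓ₁ , incΓ₂ = annotateAll-increasing false 0 Γ
      incΔ₁ , incΔ₂ = annotateAll-increasing true (nextAll 0 Γ) Δ
      Γ≤Δ = *2-mono (nextAll-≥ (nextAll 0 Γ) Δ)
  in unique boxLabs (++-increasing z≤n Γ≤Δ incΓ₁ incΔ₁) , unique boxpLabs (++-increasing z≤n Γ≤Δ incΓ₂ incΔ₂)
  where
  Γa Δa : List AFm
  Γa = annotateAll false 0 Γ
  Δa = annotateAll true (nextAll 0 Γ) Δ
  unique : ∀ {lo hi} labs → IncreasingIn lo hi (concatMap labs Γa ++ concatMap labs Δa) → Unique (concatMap labs (Γa ++ Δa))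
  unique labs inc = subst Unique (sym (concatMap-++ labs Γa Δa)) (AllPairs.map <⇒≢ (proj₁ inc))

sub-persists : ∀ s r ch st a {A i n C} → GoodS A r i → i < arityS r → ASeq.sub a ≡ just (n , C) → erase C ≡ A →
               ASeq.sub (annotatedPremise s r ch st a i) ≡ just (n , C)
sub-persists s impL     ch st a             {i = zero}  _             _ α≡   _  = α≡
sub-persists s impL     ch st a             {i = suc _} _             _ α≡   _  = α≡
sub-persists s impR     ch st a                         _             _ α≡   _  = α≡
sub-persists s (boxp A) ch st (aseq _ Δa α)             (refl , refl) _ refl eC = cong just (boxpPrincipal-sub Δa eC)

boxp-sub : ∀ {K} s r A ch (st : StepS s r ch) a → r ≡ boxp A → Annotates K a s →
  let (n , C) = boxpPrincipal (ASeq.sub a) A (ASeq.succ a) in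
  annotatedRule s r ch st a ≡ aboxp n C × ASeq.sub (annotatedPremise s r ch st a 1) ≡ just (n , C) × erase C ≡ A
boxp-sub s _ A ch (_ , _ , _ , _ , (_ , sΔ) , _) (aseq Γa Δa α) refl (annotates _ refl α∈ _ _) =
  refl , refl , proj₂ (boxpPrincipal-fits α Δa sΔ α∈)

StepA-resp : ∀ a r {ch ch′} → (∀ i → ch i ≡ ch′ i) → StepA a r ch → StepA a r ch′
StepA-resp a aaxp        e st = st
StepA-resp a aax⊥        e st = st
StepA-resp a aimpL       e (A , B , Γ , Δ , α , c , c₀ , c₁) =
  A , B , Γ , Δ , α , c , subst (_≈A _) (e 0) c₀ , subst (_≈A _) (e 1) c₁
StepA-resp a aimpR       e (A , B , Γ , Δ , α , c , c₀) = A , B , Γ , Δ , α , c , subst (_≈A _) (e 0) c₀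
StepA-resp a (abox m)    e (C , Υ , Sg , Pi , Λ , α , c , c₀) = C , Υ , Sg , Pi , Λ , α , c , subst (_≈A _) (e 0) c₀
StepA-resp a (aboxp n C) e (Υ , Sg , Pi , Λ , α , c , c₀ , c₁) =
  Υ , Sg , Pi , Λ , α , c , subst (_≈A _) (e 0) c₀ , subst (_≈A _) (e 1) c₁

-- The annotated ∞-proof

module TSFacts = TreeFacts (λ (x : NodeS) → arityS (proj₂ x))

pref-≡ : ∀ b k → TA.pref b k ≡ TS.pref b k
pref-≡ b zero    = refl
pref-≡ b (suc k) = cong (_++ [ b k ]) (pref-≡ b k)

-- The annotated proof is the unfolding of an automaton whose states pair a
-- position of π with an annotation of its sequent.  Each child position is
-- replaced by an isomorphic representative ρ; for regular π the
-- representatives range over a finite list, and so do the states.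
module Construction (π : InfProofS) (ρ : Pos → Pos)
  (ρ-ok : ∀ p → TS.Valid (InfProofS.tree π) p → TS.Valid (InfProofS.tree π) (ρ p) × TS.Iso (InfProofS.tree π) p (ρ p)) where

  T : Pos → NodeS
  T = InfProofS.tree π

  seqAt : Pos → Seq
  seqAt q = proj₁ (T q)

  ruleAt : Pos → RuleS
  ruleAt q = proj₂ (T q)

  premisesAt : Pos → ℕ → Seq
  premisesAt q i = seqAt (q ++ [ i ])

  annotatedRuleAt : Pos → ASeq → RuleA
  annotatedRuleAt q a with TSFacts.valid? T q
  ... | yes v = annotatedRule (seqAt q) (ruleAt q) (premisesAt q) (InfProofS.local π q v) a
  ... | no _  = aaxp

  annotatedPremiseAt : Pos → ASeq → ℕ → ASeq
  annotatedPremiseAt q a with TSFacts.valid? T q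
  ... | yes v = annotatedPremise (seqAt q) (ruleAt q) (premisesAt q) (InfProofS.local π q v) a
  ... | no _  = λ _ → a

  State : Set
  State = Pos × ASeq

  δ : State → ℕ → State
  δ (q , a) i = ρ (q ++ [ i ]) , annotatedPremiseAt q a i

  out : State → NodeA
  out (q , a) = a , annotatedRuleAt q a

  open Unfolding (λ (x : NodeA) → arityA (proj₂ x)) δ out public

  K : ℕ
  K = rootBound (seqAt (ρ []))

  s₀ : State
  s₀ = ρ [] , rootAnnotation (seqAt (ρ []))

  τtree : Pos → NodeA
  τtree = unfold s₀

  annotatesStepAt : ∀ q a → TS.Valid T q → Annotates K a (seqAt q) →
                    AnnotatesStep K (seqAt q) (ruleAt q) (premisesAt q) a (annotatedRuleAt q a) (annotatedPremiseAt q a)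
  annotatesStepAt q a vq ann with TSFacts.valid? T q
  ... | yes v  = annotatesStep (seqAt q) (ruleAt q) (premisesAt q) (InfProofS.local π q v) a ann
  ... | no ¬vq = ⊥-elim (¬vq vq)

  sub-persistsAt : ∀ q a {A i n C} → TS.Valid T q → GoodS A (ruleAt q) i → i < arityS (ruleAt q) →
                  ASeq.sub a ≡ just (n , C) → erase C ≡ A → ASeq.sub (annotatedPremiseAt q a i) ≡ just (n , C)
  sub-persistsAt q a vq good i< α≡ eC with TSFacts.valid? T q
  ... | yes v  = sub-persists (seqAt q) (ruleAt q) (premisesAt q) (InfProofS.local π q v) a good i< α≡ eC
  ... | no ¬vq = ⊥-elim (¬vq vq)

  boxp-subAt : ∀ q a {A} → TS.Valid T q → Annotates K a (seqAt q) → ruleAt q ≡ boxp A →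
    let (n , C) = boxpPrincipal (ASeq.sub a) A (ASeq.succ a) in
    annotatedRuleAt q a ≡ aboxp n C × ASeq.sub (annotatedPremiseAt q a 1) ≡ just (n , C) × erase C ≡ A
  boxp-subAt q a vq ann r≡ with TSFacts.valid? T q
  ... | yes v  = boxp-sub (seqAt q) (ruleAt q) _ (premisesAt q) (InfProofS.local π q v) a r≡ ann
  ... | no ¬vq = ⊥-elim (¬vq vq)

  Invariant : Pos → State → Set
  Invariant p (q , a) = TS.Valid T q × TS.Iso T p q × Annotates K a (seqAt q)

  invariant-δ : ∀ p i s → Invariant p s → i < arityA (proj₂ (out s)) → Invariant (p ++ [ i ]) (δ s i)
  invariant-δ p i (q , a) (vq , p≅q , ann) i< =
    proj₁ ρ-child , TSFacts.Iso-trans {T} {p ++ [ i ]} {q ++ [ i ]} (TSFacts.Iso-child {T} {p} {q} p≅q i<p) (proj₂ ρ-child) ,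
    subst (Annotates K _) (cong proj₁ (TSFacts.Iso⇒≡ {T} {q ++ [ i ]} (proj₂ ρ-child))) (proj₂ (proj₂ step) i i<q)
    where
    step : AnnotatesStep K (seqAt q) (ruleAt q) (premisesAt q) a (annotatedRuleAt q a) (annotatedPremiseAt q a)
    step = annotatesStepAt q a vq ann
    i<q : i < arityS (ruleAt q)
    i<q = subst (λ r → i < arityS r) (proj₁ (proj₂ step)) i<
    i<p : i < arityS (ruleAt p)
    i<p = subst (λ x → i < arityS (proj₂ x)) (sym (TSFacts.Iso⇒≡ {T} {p} {q} p≅q)) i<q
    ρ-child : TS.Valid T (ρ (q ++ [ i ])) × TS.Iso T (q ++ [ i ]) (ρ (q ++ [ i ]))
    ρ-child = ρ-ok (q ++ [ i ]) (TS.child vq i<q)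

  invariant : ∀ p → TA.Valid τtree p → Invariant p (run s₀ p)
  invariant .[] TA.root =
    let v , I = ρ-ok [] TS.root in v , I , rootAnnotation-annotates (seqAt (ρ []))
  invariant .(p ++ [ i ]) (TA.child {p} {i} v i<) =
    subst (Invariant (p ++ [ i ])) (sym (run-++ s₀ p [ i ])) (invariant-δ p i (run s₀ p) (invariant p v) i<)

  erases : ∀ p → TA.Valid τtree p → eraseNode (τtree p) ≡ T p
  erases p v with run s₀ p | invariant p v
  ... | q , a | vq , p≅q , ann = begin
    eraseNode (a , annotatedRuleAt q a)              ≡⟨ cong₂ _,_ (cong₂ _⊢_ (Annotates.ant-erases ann) (Annotates.succ-erases ann))
                                                                  (proj₁ (proj₂ (annotatesStepAt q a vq ann))) ⟩
    T q                                              ≡⟨ TSFacts.Iso⇒≡ {T} {p} p≅q ⟨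
    T p                                              ∎

  local : ∀ p → TA.Valid τtree p → StepA (proj₁ (τtree p)) (proj₂ (τtree p)) (λ i → proj₁ (τtree (p ++ [ i ])))
  local p v =
    let q , a = run s₀ p
        vq , _ , ann = invariant p v
    in StepA-resp a (annotatedRuleAt q a) (λ i → cong proj₂ (sym (run-++ s₀ p [ i ]))) (proj₁ (annotatesStepAt q a vq ann))

  wf : ∀ p → TA.Valid τtree p → WFA (proj₁ (τtree p))
  wf p v with run s₀ p | invariant p v
  ... | _ , aseq _ _ _ | _ , _ , annotates _ _ α∈ okΓ okΔ = α∈ , All.map proj₁ okΓ , All.map proj₁ okΔ

  module OnBranch (b : ℕ → ℕ) (ib : TA.InfBranch τtree b) where

    valid : ∀ k → TA.Valid τtree (TA.pref b k)
    valid zero    = TA.root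
    valid (suc k) = TA.child (valid k) (ib k)

    q : ℕ → Pos
    q k = proj₁ (run s₀ (TA.pref b k))

    a : ℕ → ASeq
    a k = proj₂ (run s₀ (TA.pref b k))

    vq : ∀ k → TS.Valid T (q k)
    vq k = proj₁ (invariant _ (valid k))

    ann : ∀ k → Annotates K (a k) (seqAt (q k))
    ann k = proj₂ (proj₂ (invariant _ (valid k)))

    a-suc : ∀ k → a (suc k) ≡ annotatedPremiseAt (q k) (a k) (b k)
    a-suc k = cong proj₂ (run-++ s₀ (TA.pref b k) [ b k ])

    rule≡ : ∀ k → ruleAt (q k) ≡ proj₂ (T (TS.pref b k))
    rule≡ k = trans (cong proj₂ (sym (TSFacts.Iso⇒≡ {T} {TA.pref b k} (proj₁ (proj₂ (invariant _ (valid k)))))))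
                    (cong (λ p → proj₂ (T p)) (pref-≡ b k))

    ibS : TS.InfBranch T b
    ibS k = subst (λ x → b k < arityS (proj₂ x)) (trans (erases _ (valid k)) (cong T (pref-≡ b k))) (ib k)

    sub-stays : ∀ {N A n C} → (∀ k → N ≤ k → GoodS A (proj₂ (T (TS.pref b k))) (b k)) → erase C ≡ A →
                ∀ k → N ≤ k → ASeq.sub (a k) ≡ just (n , C) → ASeq.sub (a (suc k)) ≡ just (n , C)
    sub-stays {A = A} {n} {C} good eC k N≤k sub≡ =
      subst (λ x → ASeq.sub x ≡ just (n , C)) (sym (a-suc k))
        (sub-persistsAt (q k) (a k) (vq k) (subst (λ r → GoodS A r (b k)) (sym (rule≡ k)) (good k N≤k))
           (subst (λ r → b k < arityS r) (sym (rule≡ k)) (ibS k)) sub≡ eC)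

    boxp-on-branch : ∀ {A} k → proj₂ (T (TS.pref b k)) ≡ boxp A →
      let (n , C) = boxpPrincipal (ASeq.sub (a k)) A (ASeq.succ (a k)) in
      annotatedRuleAt (q k) (a k) ≡ aboxp n C × ASeq.sub (annotatedPremiseAt (q k) (a k) 1) ≡ just (n , C) × erase C ≡ A
    boxp-on-branch k boxpₖ = boxp-subAt (q k) (a k) (vq k) (ann k) (trans (rule≡ k) boxpₖ)

  branch : ∀ b → TA.InfBranch τtree b →
           ∃[ N ] ∃[ n ] ∃[ C ]
             ((∀ k → N ≤ k → ASeq.sub (proj₁ (τtree (TA.pref b k))) ≡ just (n , C))
             × (∀ m → ∃[ k ] (m ≤ k × IsBoxpN n (proj₂ (τtree (TA.pref b k))) × b k ≡ 1)))
  branch b ib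
    with N , A , good , often ← InfProofS.branch π b (OnBranch.ibS b ib)
    with k₀ , N≤k₀ , boxp₀ , right₀ ← often N
    = suc k₀ , n , C , eventually , λ m → recurring m (often (m + suc k₀))
    where
    open OnBranch b ib

    n : ℕ
    n = proj₁ (boxpPrincipal (ASeq.sub (a k₀)) A (ASeq.succ (a k₀)))

    C : AFm
    C = proj₂ (boxpPrincipal (ASeq.sub (a k₀)) A (ASeq.succ (a k₀)))

    eC : erase C ≡ A
    eC = proj₂ (proj₂ (boxp-on-branch k₀ boxp₀))

    sub₀ : ASeq.sub (a (suc k₀)) ≡ just (n , C)
    sub₀ = trans (cong ASeq.sub (a-suc k₀))
                 (subst (λ i → ASeq.sub (annotatedPremiseAt (q k₀) (a k₀) i) ≡ just (n , C)) (sym right₀)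
                        (proj₁ (proj₂ (boxp-on-branch k₀ boxp₀))))

    eventually : ∀ k → suc k₀ ≤ k → ASeq.sub (a k) ≡ just (n , C)
    eventually = holds-from (suc k₀) sub₀ λ k k₀<k → sub-stays good eC k (≤-trans N≤k₀ (<⇒≤ k₀<k))

    recurring : ∀ m → ∃[ k ] (m + suc k₀ ≤ k × proj₂ (T (TS.pref b k)) ≡ boxp A × b k ≡ 1) →
                ∃[ k ] (m ≤ k × IsBoxpN n (proj₂ (τtree (TA.pref b k))) × b k ≡ 1)
    recurring m (k , m+k₀≤k , boxpₖ , rightₖ) =
      k , ≤-trans (m≤m+n m (suc k₀)) m+k₀≤k ,
      subst (IsBoxpN n) (sym (proj₁ (boxp-on-branch k boxpₖ))) (cong proj₁ principalₖ) , rightₖ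
      where
      principalₖ : boxpPrincipal (ASeq.sub (a k)) A (ASeq.succ (a k)) ≡ (n , C)
      principalₖ = trans (cong (λ α → boxpPrincipal α A (ASeq.succ (a k))) (eventually k (≤-trans (m≤n+m (suc k₀) m) m+k₀≤k)))
                         (boxpPrincipal-sub (ASeq.succ (a k)) eC)

  τ : InfProofA
  τ = record { tree = τtree ; wf = wf ; local = local ; branch = branch }

  τ-proper : ProperA τ
  τ-proper = rootAnnotation-proper (seqAt (ρ []))

-- Regularity

module Enumeration (K : ℕ) where

  annotations : Fm → List AFm
  annotations (var p)  = [ avar p ]
  annotations bot      = [ abot ]
  annotations (A ⇒ B)  = cartesianProductWith _a⇒_ (annotations A) (annotations B)
  annotations (□ A)    = cartesianProductWith a□ (upTo K) (annotations A)
  annotations (□⁺ A)   = cartesianProductWith a□⁺ (upTo K) (annotations A)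

  annotations-complete : ∀ x → LabelsBelow K x → x ∈ annotations (erase x)
  annotations-complete (avar p)  _         = here refl
  annotations-complete abot      _         = here refl
  annotations-complete (A a⇒ B)  (bA , bB) =
    ∈-cartesianProductWith⁺ _a⇒_ (annotations-complete A bA) (annotations-complete B bB)
  annotations-complete (a□ i A)  (i< , bA) = ∈-cartesianProductWith⁺ a□ (∈-upTo⁺ i<) (annotations-complete A bA)
  annotations-complete (a□⁺ i A) (i< , bA) = ∈-cartesianProductWith⁺ a□⁺ (∈-upTo⁺ i<) (annotations-complete A bA)

  annotationsAll : List Fm → List (List AFm)
  annotationsAll []       = [ [] ]
  annotationsAll (F ∷ Fs) = cartesianProductWith _∷_ (annotations F) (annotationsAll Fs)

  annotationsAll-complete : ∀ xs → All (LabelsBelow K) xs → xs ∈ annotationsAll (map erase xs)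
  annotationsAll-complete []       []         = here refl
  annotationsAll-complete (x ∷ xs) (bx ∷ bxs) =
    ∈-cartesianProductWith⁺ _∷_ (annotations-complete x bx) (annotationsAll-complete xs bxs)

  boxpSubscript : AFm → List (Maybe (ℕ × AFm))
  boxpSubscript (a□⁺ n C) = [ just (n , C) ]
  boxpSubscript _         = []

  subscripts : List AFm → List (Maybe (ℕ × AFm))
  subscripts Δ = nothing ∷ concatMap boxpSubscript Δ

  subscripts-complete : ∀ α Δ → SubIn α Δ → α ∈ subscripts Δ
  subscripts-complete nothing        Δ _   = here refl
  subscripts-complete (just (n , C)) Δ α∈ = there (∈-concatMap⁺ boxpSubscript (lose (α∈ n C refl) (here refl)))

  withSubscripts : List AFm × List AFm → List ASeq
  withSubscripts (Γ , Δ) = map (aseq Γ Δ) (subscripts Δ)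

  annotatedSeqs : Seq → List ASeq
  annotatedSeqs s = concatMap withSubscripts (cartesianProduct (annotationsAll (Seq.ant s)) (annotationsAll (Seq.succ s)))

  annotatedSeqs-complete : ∀ s a → Annotates K a s → a ∈ annotatedSeqs s
  annotatedSeqs-complete s (aseq Γ Δ α) (annotates refl refl α∈ okΓ okΔ) =
    ∈-concatMap⁺ withSubscripts
      (lose (∈-cartesianProduct⁺ (annotationsAll-complete Γ (All.map proj₂ okΓ)) (annotationsAll-complete Δ (All.map proj₂ okΔ)))
            (∈-map⁺ (aseq Γ Δ) (subscripts-complete α Δ α∈)))

module RegularCase (π : InfProofS) (reg : RegularS π) where

  private
    T : Pos → NodeS
    T = InfProofS.tree π

  reps : List Pos
  reps = proj₁ reg

  representative : (p : Pos) → ∃[ q ] (q ∈ reps × (TS.Valid T p → TS.Valid T q × TS.Iso T p q))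
  representative p with TSFacts.valid? T p
  ... | yes v = let q , q∈ , p≅q = proj₂ (proj₂ reg) p v in q , q∈ , λ _ → proj₁ (proj₂ reg) q q∈ , p≅q
  ... | no ¬v = let q , q∈ , _ = proj₂ (proj₂ reg) [] TS.root in q , q∈ , λ v → ⊥-elim (¬v v)

  ρ : Pos → Pos
  ρ p = proj₁ (representative p)

  ρ∈reps : ∀ p → ρ p ∈ reps
  ρ∈reps p = proj₁ (proj₂ (representative p))

  ρ-ok : ∀ p → TS.Valid T p → TS.Valid T (ρ p) × TS.Iso T p (ρ p)
  ρ-ok p = proj₂ (proj₂ (representative p))

  open Construction π ρ ρ-ok public
  open Enumeration K

  _≟ₛ_ : DecidableEquality State
  _≟ₛ_ = Product.≡-dec (List.≡-dec _≟_) _≟ᵃ_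

  statesAt : Pos → List State
  statesAt q = map (q ,_) (annotatedSeqs (seqAt q))

  states : List State
  states = concatMap statesAt reps

  run∈reps : ∀ s r → proj₁ s ∈ reps → proj₁ (run s r) ∈ reps
  run∈reps s []      q∈ = q∈
  run∈reps s (i ∷ r) _  = run∈reps (δ s i) r (ρ∈reps (proj₁ s ++ [ i ]))

  reachable⊆states : ∀ p → TA.Valid τtree p → run s₀ p ∈ states
  reachable⊆states p v =
    ∈-concatMap⁺ statesAt (lose (run∈reps s₀ p (ρ∈reps []))
      (∈-map⁺ (proj₁ (run s₀ p) ,_) (annotatedSeqs-complete _ _ (proj₂ (proj₂ (invariant p v))))))

  τ-regular : RegularA τ
  τ-regular = unfold-regular _≟ₛ_ s₀ states reachable⊆states

mainTheorem13 : (π : InfProofS) →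
    (∃[ τ ] (ProperA τ × Erases τ π))
    × (RegularS π → ∃[ τ ] (ProperA τ × Erases τ π × RegularA τ))
mainTheorem13 π =
  (Plain.τ , Plain.τ-proper , Plain.erases) ,
  λ reg → let module R = RegularCase π reg in R.τ , R.τ-proper , R.erases , R.τ-regular
  where
  module Plain = Construction π (λ p → p) (λ p v → v , λ _ _ → refl)
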